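{- Let $n\ge 1$ and let $X$ be the set of squares of an $n\times n$ Bingo board, with the Bingo closure and depth as defined in the context. (a) If $S\subseteq X$ is not spanning, then the depth of $S$ is at most $2n-2$. (b) If $S\subseteq X$ is spanning, then the depth of $S$ is at most $2n$.
   Context: Let $X$ be the set of $n^2$ squares of an $n\times n$ grid. A \emph{line} is one of the $n$ rows, the $n$ columns, or one of the two main diagonals ($2n+2$ lines in total). A square $s$ is \emph{dependent} on $S\subseteq X$ if there is a line $L$ with $s\in L$ and $L\setminus\{s\}\subseteq S$; let $\varphi(S)$ be the set of squares dependent on $S$, and let $\varphi_*(S)=S\cup\varphi(S)$. A set $K$ is \emph{closed} if $\varphi(K)\subseteq K$; the \emph{closure} $\mathscr{C}(S)$ is the smallest closed set containing $S$, which equals $\varphi_*^d(S)$ for all sufficiently large $d$. The \emph{depth} of $S$ is the smallest integer $d\ge 0$ with $\varphi_*^{d+1}(S)=\varphi_*^{d}(S)$ (here $\varphi_*^0(S)=S$). $S$ is \emph{spanning} if $\mathscr{C}(S)=X$. -}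

module Defs where

open import Data.Nat using (ℕ; zero; suc; _<_)
open import Data.Fin using (Fin; opposite)
open import Data.Product using (_×_; _,_; ∃; ∃-syntax; proj₁; proj₂)
open import Data.Sum using (_⊎_)
open import Relation.Binary.PropositionalEquality using (_≡_; _≢_)
open import Relation.Nullary using (¬_)
open import Data.Bool using (Bool; true)

Square : ℕ → Set
Square n = Fin n × Fin n

SqSet : ℕ → Set₁
SqSet n = Square n → Set

_⊆_ : ∀ {n} → SqSet n → SqSet n → Set
S ⊆ T = ∀ s → S s → T s

_≐_ : ∀ {n} → SqSet n → SqSet n → Set
S ≐ T = (S ⊆ T) × (T ⊆ S)

data Line (n : ℕ) : Set where
  row    : Fin n → Line n
  col    : Fin n → Line n
  diag   : Line n
  antidiag : Line n

_∈L_ : ∀ {n} → Square n → Line n → Set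
(i , j) ∈L row r = i ≡ r
(i , j) ∈L col c = j ≡ c
(i , j) ∈L diag = i ≡ j
(i , j) ∈L antidiag = j ≡ opposite i

Dependent : ∀ {n} → SqSet n → Square n → Set
Dependent {n} S s = ∃[ L ] (s ∈L L × (∀ t → t ∈L L → t ≢ s → S t))

φ* : ∀ {n} → SqSet n → SqSet n
φ* S s = S s ⊎ Dependent S s

iter : ∀ {n} → ℕ → SqSet n → SqSet n
iter zero S = S
iter (suc d) S = φ* (iter d S)

-- Closure 𝒞(S) = ⋃_d φ_*^d(S) (the smallest closed set containing S)
Closure : ∀ {n} → SqSet n → SqSet n
Closure S s = ∃[ d ] iter d S s

Spanning : ∀ {n} → SqSet n → Set
Spanning S = ∀ s → Closure S s

IsDepth : ∀ {n} → SqSet n → ℕ → Set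
IsDepth S d = (iter (suc d) S ≐ iter d S)
            × (∀ e → e < d → ¬ (iter (suc e) S ≐ iter e S))

toSet : ∀ {n} → (Square n → Bool) → SqSet n
toSet S s = S s ≡ true

-- Count the full lines (rows, columns and the two diagonals) of φ_*^t(S). A square
-- added at step t + 1 completes a line that was not full at step t, so until the
-- process stabilises this count grows at every step. After 2n − 1 steps at least
-- 2n − 1 lines are full, hence all rows but one or all columns but one, and then
-- every square is dependent at the next step. So either the depth is at most 2n − 2,
-- or φ_*^{2n}(S) is the whole board.

module Submission where

open import Defs hiding (_⊆_)
open import Data.Bool using (Bool; true)
import Data.Bool as Bool
open import Data.Nat using (ℕ; zero; suc; _+_; _*_; _∸_; _≤_; _<_; _≤?_; z≤n; s≤s; NonZero; ≢-nonZero⁻¹)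
open import Data.Nat.Properties
open import Data.Nat.Tactic.RingSolver using (solve-∀)
open import Data.Fin using (Fin; opposite) renaming (zero to fzero; suc to fsuc)
import Data.Fin as Fin
open import Data.Fin.Properties using (all?; any?)
open import Data.Fin.Subset using (Subset; _∈_; _⊆_; _⊂_; ∣_∣; ∁; ⁅_⁆)
open import Data.Fin.Subset.Properties
  using (p⊆q⇒∣p∣≤∣q∣; p⊂q⇒∣p∣<∣q∣; ∣p∣≤n; ∣⁅x⁆∣≡1; ∣∁p∣≡n∸∣p∣; x∈⁅y⁆⇒x≡y; x∉p⇒x∈∁p)
open import Data.Vec using (tabulate)
open import Data.Vec.Properties using (lookup∘tabulate; lookup⇒[]=; []=⇒lookup)
open import Data.Product using (_×_; ∃-syntax; _,_; proj₁; proj₂)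
import Data.Product.Properties as Product
open import Data.Sum using (_⊎_; inj₁; inj₂; [_,_]′)
open import Data.Empty using (⊥-elim)
open import Function using (_∘_)
open import Relation.Nullary using (¬_; Dec; yes; no; does; ¬?)
open import Relation.Nullary.Decidable using (map′; dec-true; _×-dec_; _⊎-dec_; _→-dec_)
open import Relation.Binary.PropositionalEquality using (_≡_; refl; sym; trans; cong; subst; _≢_)

subsetOf : ∀ {k} {P : Fin k → Set} → (∀ i → Dec (P i)) → Subset k
subsetOf P? = tabulate (λ i → does (P? i))

∈-subsetOf⁺ : ∀ {k} {P : Fin k → Set} (P? : ∀ i → Dec (P i)) {i} → P i → i ∈ subsetOf P?
∈-subsetOf⁺ P? {i} p = lookup⇒[]= i _ (trans (lookup∘tabulate _ i) (dec-true (P? i) p))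

∈-subsetOf⁻ : ∀ {k} {P : Fin k → Set} (P? : ∀ i → Dec (P i)) {i} → i ∈ subsetOf P? → P i
∈-subsetOf⁻ P? {i} i∈ with P? i | trans (sym (lookup∘tabulate (λ j → does (P? j)) i)) ([]=⇒lookup i∈)
... | yes p | _ = p
... | no _  | ()

∣p∣≤1⇒unique : ∀ {k} {p : Subset k} {i j} → ∣ p ∣ ≤ 1 → i ∈ p → j ∈ p → i ≡ j
∣p∣≤1⇒unique {p = p} {i} {j} ∣p∣≤1 i∈p j∈p with i Fin.≟ j
... | yes i≡j = i≡j
... | no i≢j = ⊥-elim (<⇒≱ (subst (_< ∣ p ∣) (∣⁅x⁆∣≡1 i) (p⊂q⇒∣p∣<∣q∣ ⁅i⁆⊂p)) ∣p∣≤1)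
  where
  ⁅i⁆⊂p : ⁅ i ⁆ ⊂ p
  ⁅i⁆⊂p = (λ x∈⁅i⁆ → subst (_∈ p) (sym (x∈⁅y⁆⇒x≡y i x∈⁅i⁆)) i∈p)
        , j , j∈p , λ j∈⁅i⁆ → i≢j (sym (x∈⁅y⁆⇒x≡y i j∈⁅i⁆))

∣∁p∣≤1 : ∀ {k} (p : Subset k) → k ≤ ∣ p ∣ + 1 → ∣ ∁ p ∣ ≤ 1
∣∁p∣≤1 {k} p k≤∣p∣+1 = subst (_≤ 1) (sym (∣∁p∣≡n∸∣p∣ p)) (m≤n+o⇒m∸n≤o k ∣ p ∣ k≤∣p∣+1)

least-≤ : {P : ℕ → Set} → (∀ e → Dec (P e)) → ∀ b →
          (∃[ e ] (e ≤ b × P e × (∀ e′ → e′ < e → ¬ P e′))) ⊎ (∀ e → e ≤ b → ¬ P e)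
least-≤ P? zero with P? zero
... | yes p = inj₁ (zero , z≤n , p , λ _ ())
... | no ¬p = inj₂ λ { zero z≤n → ¬p }
least-≤ P? (suc b) with least-≤ P? b
... | inj₁ (e , e≤b , p , below) = inj₁ (e , m≤n⇒m≤1+n e≤b , p , below)
... | inj₂ none with P? (suc b)
...   | yes p = inj₁ (suc b , ≤-refl , p , λ e e<1+b → none e (≤-pred e<1+b))
...   | no ¬p = inj₂ λ e e≤1+b →
                  [ (λ e<1+b → none e (≤-pred e<1+b)) , (λ { refl → ¬p }) ]′ (m≤n⇒m<n∨m≡n e≤1+b)

n≤r+1⊎n≤c+1 : ∀ n r c d → d ≤ 2 → n + n ≤ suc (r + c + d) → n ≤ r + 1 ⊎ n ≤ c + 1
n≤r+1⊎n≤c+1 n r c d d≤2 n+n≤ with n ≤? r + 1 | n ≤? c + 1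
... | yes n≤r+1 | _         = inj₁ n≤r+1
... | no _      | yes n≤c+1 = inj₂ n≤c+1
... | no n≰r+1  | no n≰c+1  = ⊥-elim (<⇒≱ too-small (+-mono-≤ (≰⇒> n≰r+1) (≰⇒> n≰c+1)))
  where
  open ≤-Reasoning
  rearrange : ∀ x y → suc (suc (x + y + 2)) ≡ suc (x + 1) + suc (y + 1)
  rearrange = solve-∀
  too-small : n + n < suc (r + 1) + suc (c + 1)
  too-small = begin-strict
    n + n                  ≤⟨ n+n≤ ⟩
    suc (r + c + d)        <⟨ s≤s (s≤s (+-monoʳ-≤ (r + c) d≤2)) ⟩
    suc (suc (r + c + 2))  ≡⟨ rearrange r c ⟩
    suc (r + 1) + suc (c + 1) ∎

_≟ₛ_ : ∀ {n} (s t : Square n) → Dec (s ≡ t)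
_≟ₛ_ = Product.≡-dec Fin._≟_ Fin._≟_

_∈L?_ : ∀ {n} (s : Square n) (L : Line n) → Dec (s ∈L L)
(i , j) ∈L? row r    = i Fin.≟ r
(i , j) ∈L? col c    = j Fin.≟ c
(i , j) ∈L? diag     = i Fin.≟ j
(i , j) ∈L? antidiag = j Fin.≟ opposite i

all-squares? : ∀ {n} {P : Square n → Set} → (∀ s → Dec (P s)) → Dec (∀ s → P s)
all-squares? P? = map′ (λ p (i , j) → p i j) (λ p i j → p (i , j)) (all? λ i → all? λ j → P? (i , j))

dependent? : ∀ {n} {T : SqSet n} → (∀ s → Dec (T s)) → ∀ s → Dec (Dependent T s)
dependent? {n} {T} T? s =
  map′ to from ((any? (via ∘ row) ⊎-dec any? (via ∘ col)) ⊎-dec (via diag ⊎-dec via antidiag))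
  where
  Via : Line n → Set
  Via L = s ∈L L × (∀ t → t ∈L L → t ≢ s → T t)
  via : ∀ L → Dec (Via L)
  via L = (s ∈L? L) ×-dec all-squares? (λ t → (t ∈L? L) →-dec (¬? (t ≟ₛ s) →-dec T? t))
  ViaSomeLine : Set
  ViaSomeLine = (∃[ r ] Via (row r) ⊎ ∃[ c ] Via (col c)) ⊎ (Via diag ⊎ Via antidiag)
  to : ViaSomeLine → Dependent T s
  to (inj₁ (inj₁ (r , v))) = row r , v
  to (inj₁ (inj₂ (c , v))) = col c , v
  to (inj₂ (inj₁ v))       = diag , v
  to (inj₂ (inj₂ v))       = antidiag , v
  from : Dependent T s → ViaSomeLine
  from (row r , v)    = inj₁ (inj₁ (r , v))
  from (col c , v)    = inj₁ (inj₂ (c , v))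
  from (diag , v)     = inj₂ (inj₁ v)
  from (antidiag , v) = inj₂ (inj₂ v)

record ParallelClass (n : ℕ) : Set where
  field
    line                  : Fin n → Line n
    index                 : Square n → Fin n
    ∈-line                : ∀ s → s ∈L line (index s)
    transversal           : Square n → Line n
    ∈-transversal         : ∀ s → s ∈L transversal s
    transversal-separates : ∀ {s u} → u ∈L transversal s → index u ≡ index s → u ≡ s

rows : ∀ {n} → ParallelClass n
rows = record
  { line = row ; index = proj₁ ; ∈-line = λ _ → refl
  ; transversal = λ (_ , j) → col j ; ∈-transversal = λ _ → refl
  ; transversal-separates = λ { {_ , _} {_ , _} refl refl → refl } }

columns : ∀ {n} → ParallelClass n
columns = record
  { line = col ; index = proj₂ ; ∈-line = λ _ → refl
  ; transversal = λ (i , _) → row i ; ∈-transversal = λ _ → refl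
  ; transversal-separates = λ { {_ , _} {_ , _} refl refl → refl } }

diagonal : ∀ {n} → Fin 2 → Line n
diagonal fzero        = diag
diagonal (fsuc fzero) = antidiag

module Closure {n} {S : SqSet n} (S? : ∀ s → Dec (S s)) where

  Φ : ℕ → SqSet n
  Φ d = iter d S

  Φ? : ∀ d s → Dec (Φ d s)
  Φ? zero    = S?
  Φ? (suc d) s = Φ? d s ⊎-dec dependent? (Φ? d) s

  Stable : ℕ → Set
  Stable t = ∀ s → Φ (suc t) s → Φ t s

  Stable? : ∀ t → Dec (Stable t)
  Stable? t = all-squares? (λ s → Φ? (suc t) s →-dec Φ? t s)

  first-Stable⇒IsDepth : ∀ {d} → Stable d → (∀ e → e < d → ¬ Stable e) → IsDepth S d
  first-Stable⇒IsDepth stable below = (stable , λ _ → inj₁) , λ e e<d (stable-e , _) → below e e<d stable-e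

  depth-≤ : ∀ {t} → Stable t → ∃[ d ] (IsDepth S d × d ≤ t)
  depth-≤ {t} stable with least-≤ Stable? t
  ... | inj₁ (d , d≤t , stable-d , below) = d , first-Stable⇒IsDepth stable-d below , d≤t
  ... | inj₂ none = ⊥-elim (none t ≤-refl stable)

  Full : ℕ → Line n → Set
  Full t L = ∀ u → u ∈L L → Φ t u

  Full? : ∀ t L → Dec (Full t L)
  Full? t L = all-squares? (λ u → (u ∈L? L) →-dec Φ? t u)

  dependent⇒Full : ∀ {t s L} → s ∈L L → (∀ u → u ∈L L → u ≢ s → Φ t u) → Full (suc t) L
  dependent⇒Full {s = s} s∈L others u u∈L with u ≟ₛ s
  ... | yes refl = inj₂ (_ , s∈L , others)
  ... | no u≢s   = inj₁ (others u u∈L u≢s)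

  fullAmong : ∀ {k} → (Fin k → Line n) → ℕ → Subset k
  fullAmong line t = subsetOf (λ i → Full? t (line i))

  ∈-fullAmong⁺ : ∀ {k} (line : Fin k → Line n) t {i} → Full t (line i) → i ∈ fullAmong line t
  ∈-fullAmong⁺ line t = ∈-subsetOf⁺ (λ i → Full? t (line i))

  ∈-fullAmong⁻ : ∀ {k} (line : Fin k → Line n) t {i} → i ∈ fullAmong line t → Full t (line i)
  ∈-fullAmong⁻ line t = ∈-subsetOf⁻ (λ i → Full? t (line i))

  fullAmong-⊆ : ∀ {k} (line : Fin k → Line n) t → fullAmong line t ⊆ fullAmong line (suc t)
  fullAmong-⊆ line t i∈ = ∈-fullAmong⁺ line (suc t) λ u u∈L → inj₁ (∈-fullAmong⁻ line t i∈ u u∈L)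

  ∣fullAmong∣-< : ∀ {k} (line : Fin k → Line n) t {i} → Full (suc t) (line i) → ¬ Full t (line i) →
                   ∣ fullAmong line t ∣ < ∣ fullAmong line (suc t) ∣
  ∣fullAmong∣-< line t full ¬full =
    p⊂q⇒∣p∣<∣q∣ (fullAmong-⊆ line t , _ , ∈-fullAmong⁺ line (suc t) full , ¬full ∘ ∈-fullAmong⁻ line t)

  ∣fullAmong∣-≤ : ∀ {k} (line : Fin k → Line n) t → ∣ fullAmong line t ∣ ≤ ∣ fullAmong line (suc t) ∣
  ∣fullAmong∣-≤ line t = p⊆q⇒∣p∣≤∣q∣ (fullAmong-⊆ line t)

  fullLines : ℕ → ℕ
  fullLines t = ∣ fullAmong row t ∣ + ∣ fullAmong col t ∣ + ∣ fullAmong diagonal t ∣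

  fullLines-< : ∀ t L → Full (suc t) L → ¬ Full t L → fullLines t < fullLines (suc t)
  fullLines-< t (row i) full ¬full =
    +-mono-<-≤ (+-mono-<-≤ (∣fullAmong∣-< row t full ¬full) (∣fullAmong∣-≤ col t)) (∣fullAmong∣-≤ diagonal t)
  fullLines-< t (col i) full ¬full =
    +-mono-<-≤ (+-mono-≤-< (∣fullAmong∣-≤ row t) (∣fullAmong∣-< col t full ¬full)) (∣fullAmong∣-≤ diagonal t)
  fullLines-< t diag full ¬full =
    +-mono-≤-< (+-mono-≤ (∣fullAmong∣-≤ row t) (∣fullAmong∣-≤ col t)) (∣fullAmong∣-< diagonal t {fzero} full ¬full)
  fullLines-< t antidiag full ¬full =
    +-mono-≤-< (+-mono-≤ (∣fullAmong∣-≤ row t) (∣fullAmong∣-≤ col t)) (∣fullAmong∣-< diagonal t {fsuc fzero} full ¬full)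

  fullLines-≤⇒Stable : ∀ t → fullLines (suc t) ≤ fullLines t → Stable t
  fullLines-≤⇒Stable t _ s (inj₁ s∈) = s∈
  fullLines-≤⇒Stable t no-growth s (inj₂ (L , s∈L , others)) with Full? t L
  ... | yes full = full s s∈L
  ... | no ¬full = ⊥-elim (<⇒≱ (fullLines-< t L (dependent⇒Full {t} s∈L others) ¬full) no-growth)

  fullLines-≥ : ∀ t → (∀ e → e < t → ¬ Stable e) → t ≤ fullLines t
  fullLines-≥ zero    _        = z≤n
  fullLines-≥ (suc t) unstable = ≤-<-trans
    (fullLines-≥ t λ e e<t → unstable e (m≤n⇒m≤1+n e<t))
    (≰⇒> λ no-growth → unstable t ≤-refl (fullLines-≤⇒Stable t no-growth))

  module _ (P : ParallelClass n) where
    open ParallelClass P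

    complete-if-one-line-open : ∀ t → ∣ ∁ (fullAmong line t) ∣ ≤ 1 → ∀ s → Φ (suc t) s
    complete-if-one-line-open t at-most-one s with Full? t (line (index s))
    ... | yes full = inj₁ (full s (∈-line s))
    ... | no ¬full = inj₂ (transversal s , ∈-transversal s , others)
      where
      open-line : ∀ {i} → ¬ Full t (line i) → i ∈ ∁ (fullAmong line t)
      open-line ¬full-i = x∉p⇒x∈∁p (¬full-i ∘ ∈-fullAmong⁻ line t)
      others : ∀ u → u ∈L transversal s → u ≢ s → Φ t u
      others u u∈ u≢s with Full? t (line (index u))
      ... | yes full-u = full-u u (∈-line u)
      ... | no ¬full-u =
            ⊥-elim (u≢s (transversal-separates u∈ (∣p∣≤1⇒unique at-most-one (open-line ¬full-u) (open-line ¬full))))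

  complete-if-many-full : ∀ t → n + n ≤ suc (fullLines t) → ∀ s → Φ (suc t) s
  complete-if-many-full t many with n≤r+1⊎n≤c+1 n _ _ _ (∣p∣≤n (fullAmong diagonal t)) many
  ... | inj₁ rows-full = complete-if-one-line-open rows t (∣∁p∣≤1 (fullAmong row t) rows-full)
  ... | inj₂ cols-full = complete-if-one-line-open columns t (∣∁p∣≤1 (fullAmong col t) cols-full)

  stabilises-by-or-complete : ∀ b → n + n ≤ suc (suc b) →
                              (∃[ d ] (IsDepth S d × d ≤ b)) ⊎ (∀ s → Φ (suc (suc b)) s)
  stabilises-by-or-complete b n+n≤ with least-≤ Stable? b
  ... | inj₁ (d , d≤b , stable , below) = inj₁ (d , first-Stable⇒IsDepth stable below , d≤b)
  ... | inj₂ none = inj₂ (complete-if-many-full (suc b)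
          (≤-trans n+n≤ (s≤s (fullLines-≥ (suc b) λ e e<1+b → none e (≤-pred e<1+b)))))

2*[1+m]≡2+[m+m] : ∀ m → 2 * suc m ≡ suc (suc (m + m))
2*[1+m]≡2+[m+m] = solve-∀

mainTheorem2 : (n : ℕ) → .{{_ : NonZero n}} → (S : Square n → Bool) →
    ((¬ Spanning (toSet S) → ∃[ d ] (IsDepth (toSet S) d × d ≤ 2 * n ∸ 2))
    × (Spanning (toSet S) → ∃[ d ] (IsDepth (toSet S) d × d ≤ 2 * n)))
mainTheorem2 zero {{n≢0}} S = ⊥-elim (≢-nonZero⁻¹ 0 {{n≢0}} refl)
mainTheorem2 (suc m) S = non-spanning , spanning
  where
  open Closure (λ s → S s Bool.≟ true)
  2n≡2+2m : 2 * suc m ≡ suc (suc (m + m))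
  2n≡2+2m = 2*[1+m]≡2+[m+m] m
  dichotomy : (∃[ d ] (IsDepth (toSet S) d × d ≤ m + m)) ⊎ (∀ s → Φ (suc (suc (m + m))) s)
  dichotomy = stabilises-by-or-complete (m + m) (≤-reflexive (cong suc (+-suc m m)))
  non-spanning : ¬ Spanning (toSet S) → ∃[ d ] (IsDepth (toSet S) d × d ≤ 2 * suc m ∸ 2)
  non-spanning ¬spanning with dichotomy
  ... | inj₁ (d , depth , d≤) = d , depth , subst (d ≤_) (sym (cong (_∸ 2) 2n≡2+2m)) d≤
  ... | inj₂ complete = ⊥-elim (¬spanning λ s → suc (suc (m + m)) , complete s)
  spanning : Spanning (toSet S) → ∃[ d ] (IsDepth (toSet S) d × d ≤ 2 * suc m)
  spanning _ with dichotomy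
  ... | inj₁ (d , depth , d≤) = d , depth , ≤-trans d≤ (≤-trans (m≤n+m _ 2) (≤-reflexive (sym 2n≡2+2m)))
  ... | inj₂ complete = subst (λ b → ∃[ d ] (IsDepth (toSet S) d × d ≤ b)) (sym 2n≡2+2m) (depth-≤ λ s _ → complete s)
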